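{- For every oriented graph $D$ there is a tournament $T$ with $V(T)=V(D)$ and $A(D)\subseteq A(T)$ such that $\operatorname{inv}(T)=\operatorname{inv}(D)$.
   Context: An oriented graph is a digraph with no loops, no multiple arcs and no directed cycle of length 2. Inverting a vertex set $X$ means reversing every arc with both ends in $X$. $\operatorname{inv}(D)$ is the minimum number of successive inversions needed to make the oriented graph $D$ acyclic. -}

module Defs where

open import Data.Nat using (ℕ; _<_)
open import Data.Fin using (Fin)
open import Data.Bool using (Bool; true; false; _∧_; if_then_else_)
open import Data.Vec using (lookup)
open import Data.Fin.Subset using (Subset)
open import Data.List using (List; length; foldl)
open import Data.Product using (Σ; _×_; ∃-syntax)
open import Data.Sum using (_⊎_)
open import Relation.Nullary using (¬_)
open import Relation.Binary.PropositionalEquality using (_≡_; _≢_)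
open import Relation.Binary.Construct.Closure.Transitive using (TransClosure)

Digraph : ℕ → Set
Digraph n = Fin n → Fin n → Bool

Arc : ∀ {n} → Digraph n → Fin n → Fin n → Set
Arc D u v = D u v ≡ true

Oriented : ∀ {n} → Digraph n → Set
Oriented {n} D = (∀ (u : Fin n) → ¬ Arc D u u)
               × (∀ (u v : Fin n) → Arc D u v → ¬ Arc D v u)

Tournament : ∀ {n} → Digraph n → Set
Tournament {n} D = Oriented D
                 × (∀ (u v : Fin n) → u ≢ v → Arc D u v ⊎ Arc D v u)

ArcSubset : ∀ {n} → Digraph n → Digraph n → Set
ArcSubset {n} D T = ∀ (u v : Fin n) → Arc D u v → Arc T u v

inside : ∀ {n} → Subset n → Fin n → Bool
inside X u = lookup X u

invert : ∀ {n} → Digraph n → Subset n → Digraph n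
invert D X u v = if inside X u ∧ inside X v then D v u else D u v

invertAll : ∀ {n} → Digraph n → List (Subset n) → Digraph n
invertAll D Xs = foldl invert D Xs

Acyclic : ∀ {n} → Digraph n → Set
Acyclic {n} D = ∀ (u : Fin n) → ¬ TransClosure (Arc D) u u

AcyclicAfter : ∀ {n} → Digraph n → ℕ → Set
AcyclicAfter {n} D k = ∃[ Xs ] (length {A = Subset n} Xs ≡ k × Acyclic (invertAll D Xs))

IsInv : ∀ {n} → Digraph n → ℕ → Set
IsInv D k = AcyclicAfter D k × (∀ j → j < k → ¬ AcyclicAfter D j)

-- Let Xs be a shortest list of inversions making D acyclic, and extend the acyclic digraph
-- D′ it produces to an acyclic tournament T′ by linearly extending a ranking of D′. Undoing
-- Xs on T′ (inverting in reverse order) gives a tournament T ⊇ D that Xs again makes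
-- acyclic, so inv T ≤ inv D; and inversions making T acyclic make its subgraph D acyclic,
-- so inv D ≤ inv T. Constructively, inv D must also be shown to exist: acyclicity of a
-- finite digraph is decidable via longest-walk heights, and D becomes acyclic once the
-- endpoints of each arc pointing backwards in the vertex order are inverted in turn.

module Submission where

open import Defs
open import Data.Bool using (Bool; true; false; _∧_; if_then_else_)
open import Data.Bool.Properties using (T-≡)
open import Data.Fin using (Fin; toℕ)
open import Data.Fin.Properties using (toℕ<n; toℕ-injective; toℕ≤pred[n]; pigeonhole; all?; ¬∀⟶∃¬)
open import Data.Fin.Subset using (Subset; ⁅_⁆; _∪_)
open import Data.Fin.Subset.Properties using (x∈⁅x⁆; x∈⁅y⁆⇒x≡y; x∈p∪q⁻; x∈p∪q⁺; anySubset?)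
open import Data.List using (List; []; _∷_; _∷ʳ_; length; reverse; map; allFin; cartesianProduct)
open import Data.List.Properties using (foldl-∷ʳ; unfold-reverse; reverse-involutive)
open import Data.List.Extrema.Nat using (max; xs≤max; argmax-sel)
open import Data.List.Membership.Propositional using (_∉_)
open import Data.List.Membership.Propositional.Properties using (∈-map⁺; ∈-map⁻; ∈-allFin; ∈-cartesianProduct⁺)
open import Data.List.Relation.Unary.All using (lookup)
open import Data.List.Relation.Unary.Any using (here; there)
open import Data.Nat using (ℕ; zero; suc; _+_; _*_; _≤_; _<_; _<ᵇ_; _≤?_; _<?_; s≤s)
open import Data.Nat.DivMod using (_%_; [m+kn]%n≡m%n; m<n⇒m%n≡m)
open import Data.Nat.Induction using (<-rec)
open import Data.Nat.Properties
  using ( <-irrefl; <-asym; <-trans; <-cmp; <-≤-trans; ≤-trans; ≤-pred; <⇒≤; ≰⇒>; n<1+n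
        ; m≤n⇒m≤1+n; m≤n⇒m<n∨m≡n; m≤n+m; +-monoˡ-<; *-monoˡ-≤; suc-injective
        ; <ᵇ⇒<; <⇒<ᵇ; anyUpTo? )
open import Data.Product using (Σ; Σ-syntax; _×_; _,_; proj₁; proj₂; ∃; ∃-syntax)
open import Data.Sum using (_⊎_; inj₁; inj₂)
import Data.Sum as Sum
open import Data.Vec.Properties using ([]=⇒lookup; lookup⇒[]=)
open import Function using (_∘_)
open import Function.Bundles using (_⇔_; mk⇔; Equivalence)
open import Function.Definitions using (Injective)
open import Relation.Binary.Construct.Closure.Transitive using (TransClosure; [_]; _∷_)
open import Relation.Binary.Definitions using (tri<; tri≈; tri>)
open import Relation.Binary.PropositionalEquality
open import Relation.Nullary using (¬_; Dec; yes; no; contradiction)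
import Relation.Nullary.Decidable as Dec
open import Relation.Unary using (Decidable)

private
  variable
    n k : ℕ
    G H : Digraph n

_≐_ : Digraph n → Digraph n → Set
G ≐ H = ∀ u v → G u v ≡ H u v

≐⇒⊆ : G ≐ H → ArcSubset G H
≐⇒⊆ G≐H u v uv = trans (sym (G≐H u v)) uv

≐⇒⊇ : G ≐ H → ArcSubset H G
≐⇒⊇ G≐H u v uv = trans (G≐H u v) uv

⊆-trans : {F : Digraph n} → ArcSubset F G → ArcSubset G H → ArcSubset F H
⊆-trans F⊆G G⊆H u v = G⊆H u v ∘ F⊆G u v

invert-swaps-or-fixes : ∀ (G : Digraph n) X u v →
  (invert G X u v ≡ G v u × invert G X v u ≡ G u v) ⊎
  (invert G X u v ≡ G u v × invert G X v u ≡ G v u)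
invert-swaps-or-fixes G X u v with inside X u | inside X v
... | true  | true  = inj₁ (refl , refl)
... | true  | false = inj₂ (refl , refl)
... | false | true  = inj₂ (refl , refl)
... | false | false = inj₂ (refl , refl)

invert-oriented : ∀ X → Oriented G → Oriented (invert G X)
invert-oriented {G = G} X (loopless , antisym) = loopless′ , antisym′
  where
  loopless′ : ∀ u → ¬ Arc (invert G X) u u
  loopless′ u with invert-swaps-or-fixes G X u u
  ... | inj₁ (uu , _) = loopless u ∘ trans (sym uu)
  ... | inj₂ (uu , _) = loopless u ∘ trans (sym uu)

  antisym′ : ∀ u v → Arc (invert G X) u v → ¬ Arc (invert G X) v u
  antisym′ u v with invert-swaps-or-fixes G X u v
  ... | inj₁ (uv , vu) = λ a b → antisym v u (trans (sym uv) a) (trans (sym vu) b)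
  ... | inj₂ (uv , vu) = λ a b → antisym u v (trans (sym uv) a) (trans (sym vu) b)

invert-tournament : ∀ X → Tournament G → Tournament (invert G X)
invert-tournament {G = G} X (oriented , total) = invert-oriented X oriented , total′
  where
  total′ : ∀ u v → u ≢ v → Arc (invert G X) u v ⊎ Arc (invert G X) v u
  total′ u v u≢v with invert-swaps-or-fixes G X u v | total u v u≢v
  ... | inj₁ (_  , vu) | inj₁ a = inj₂ (trans vu a)
  ... | inj₁ (uv , _ ) | inj₂ b = inj₁ (trans uv b)
  ... | inj₂ (uv , _ ) | inj₁ a = inj₁ (trans uv a)
  ... | inj₂ (_  , vu) | inj₂ b = inj₂ (trans vu b)

invertAll-preserves : (P : Digraph n → Set) → (∀ {G} X → P G → P (invert G X)) →
                      ∀ Xs → P G → P (invertAll G Xs)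
invertAll-preserves P pres []       p = p
invertAll-preserves P pres (X ∷ Xs) p = invertAll-preserves P pres Xs (pres X p)

invert-⊆ : ∀ X → ArcSubset G H → ArcSubset (invert G X) (invert H X)
invert-⊆ X G⊆H u v with inside X u ∧ inside X v
... | true  = G⊆H v u
... | false = G⊆H u v

invertAll-⊆ : ∀ Xs → ArcSubset G H → ArcSubset (invertAll G Xs) (invertAll H Xs)
invertAll-⊆ []       G⊆H = G⊆H
invertAll-⊆ (X ∷ Xs) G⊆H = invertAll-⊆ Xs (invert-⊆ X G⊆H)

invert-cong : ∀ X → G ≐ H → invert G X ≐ invert H X
invert-cong X G≐H u v with inside X u ∧ inside X v
... | true  = G≐H v u
... | false = G≐H u v

invert-involutive : ∀ (G : Digraph n) X → invert (invert G X) X ≐ G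
invert-involutive G X u v with inside X u | inside X v
... | true  | true  = refl
... | true  | false = refl
... | false | true  = refl
... | false | false = refl

invertAll-reverse-inverseʳ : ∀ Xs → invertAll (invertAll G Xs) (reverse Xs) ≐ G
invertAll-reverse-inverseʳ []                   u v = refl
invertAll-reverse-inverseʳ {G = G} (X ∷ Xs) u v = begin
  invertAll (invertAll (invert G X) Xs) (reverse (X ∷ Xs)) u v
    ≡⟨ cong (λ Ys → invertAll (invertAll (invert G X) Xs) Ys u v) (unfold-reverse X Xs) ⟩
  invertAll (invertAll (invert G X) Xs) (reverse Xs ∷ʳ X) u v
    ≡⟨ cong (λ H → H u v) (foldl-∷ʳ invert _ X (reverse Xs)) ⟩
  invert (invertAll (invertAll (invert G X) Xs) (reverse Xs)) X u v
    ≡⟨ invert-cong X (invertAll-reverse-inverseʳ Xs) u v ⟩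
  invert (invert G X) X u v
    ≡⟨ invert-involutive G X u v ⟩
  G u v ∎
  where open ≡-Reasoning

invertAll-reverse-inverseˡ : ∀ Xs → invertAll (invertAll G (reverse Xs)) Xs ≐ G
invertAll-reverse-inverseˡ {G = G} Xs =
  subst (λ Ys → invertAll (invertAll G (reverse Xs)) Ys ≐ G)
        (reverse-involutive Xs) (invertAll-reverse-inverseʳ (reverse Xs))

acyclic-anti : ArcSubset G H → Acyclic H → Acyclic G
acyclic-anti {G = G} {H = H} G⊆H acyclicH u = acyclicH u ∘ lift
  where
  lift : ∀ {x y} → TransClosure (Arc G) x y → TransClosure (Arc H) x y
  lift [ xy ]     = [ G⊆H _ _ xy ]
  lift (xy ∷ yz) = G⊆H _ _ xy ∷ lift yz

Ranking : Digraph n → (Fin n → ℕ) → Set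
Ranking G r = ∀ u v → Arc G u v → r u < r v

ranking⇒acyclic : ∀ {r} → Ranking G r → Acyclic G
ranking⇒acyclic {G = G} {r = r} ranking u = <-irrefl refl ∘ increasing
  where
  increasing : ∀ {x y} → TransClosure (Arc G) x y → r x < r y
  increasing [ xy ]     = ranking _ _ xy
  increasing (xy ∷ yz) = <-trans (ranking _ _ xy) (increasing yz)

maxOver : (Fin n → ℕ) → ℕ
maxOver {n} f = max 0 (map f (allFin n))

maxOver-≥ : ∀ (f : Fin n → ℕ) w → f w ≤ maxOver f
maxOver-≥ {n} f w = lookup (xs≤max 0 (map f (allFin n))) (∈-map⁺ f (∈-allFin w))

maxOver-attained : ∀ (f : Fin n → ℕ) {x} → x < maxOver f → ∃[ w ] x < f w
maxOver-attained {n} f x<max with argmax-sel (λ m → m) 0 (map f (allFin n))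
... | inj₁ max≡0 = contradiction (subst (_ <_) max≡0 x<max) λ ()
... | inj₂ max∈fs with ∈-map⁻ f max∈fs
...   | w , _ , max≡fw = w , subst (_ <_) max≡fw x<max

module Height (G : Digraph n) where

  -- height t v: the length of a longest walk with at most t arcs ending at v.
  height : ℕ → Fin n → ℕ
  height zero    v = 0
  height (suc t) v = maxOver (λ w → if G w v then suc (height t w) else 0)

  height-arc : ∀ t {w v} → Arc G w v → suc (height t w) ≤ height (suc t) v
  height-arc t {w} {v} wv =
    subst (λ b → (if b then suc (height t w) else 0) ≤ height (suc t) v) wv
          (maxOver-≥ (λ w′ → if G w′ v then suc (height t w′) else 0) w)

  height-attained : ∀ t {v x} → x < height (suc t) v → ∃[ w ] Arc G w v × x ≤ height t w
  height-attained t {v} x<h with maxOver-attained (λ w → if G w v then suc (height t w) else 0) x<h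
  ... | w , x<hw with G w v in wv
  ...   | true  = w , wv , ≤-pred x<hw

  Walk : ℕ → Fin n → Set
  Walk t v = Σ[ f ∈ (ℕ → Fin n) ] f 0 ≡ v × (∀ i → i < t → Arc G (f (suc i)) (f i))

  walk-cons : ∀ {t w v} → Arc G w v → Walk t w → Walk (suc t) v
  walk-cons {v = v} wv (f , f0≡w , arcs) = f′ , refl , arcs′
    where
    f′ : ℕ → Fin _
    f′ zero    = v
    f′ (suc i) = f i
    arcs′ : ∀ i → i < suc _ → Arc G (f′ (suc i)) (f′ i)
    arcs′ zero    _         = subst (λ x → Arc G x v) (sym f0≡w) wv
    arcs′ (suc i) (s≤s i<t) = arcs i i<t

  height-growth⇒walk : ∀ t {v} → height t v < height (suc t) v → Walk (suc t) v
  height-growth⇒walk zero    grows with height-attained zero grows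
  ... | w , wv , _ = walk-cons wv ((λ _ → w) , refl , λ _ ())
  height-growth⇒walk (suc t) grows with height-attained (suc t) grows
  ... | w , wv , hv≤hw =
    walk-cons wv (height-growth⇒walk t (≤-trans (height-arc t wv) hv≤hw))

  walk-segment : ∀ {t v} ((f , _ , arcs) : Walk t v) {i j} → i < j → j ≤ t →
                 TransClosure (Arc G) (f j) (f i)
  walk-segment walk@(f , _ , arcs) {i} {suc j} (s≤s i≤j) j<t with m≤n⇒m<n∨m≡n i≤j
  ... | inj₁ i<j  = arcs j j<t ∷ walk-segment walk i<j (<⇒≤ j<t)
  ... | inj₂ refl = [ arcs i j<t ]

  long-walk⇒cycle : ∀ {v} → Walk (suc n) v → ∃[ u ] TransClosure (Arc G) u u
  long-walk⇒cycle walk@(f , _ , _) with pigeonhole (n<1+n n) (λ i → f (toℕ i))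
  ... | i , j , i<j , fi≡fj =
    f (toℕ j) , subst (TransClosure (Arc G) (f (toℕ j))) fi≡fj
                      (walk-segment walk i<j (m≤n⇒m≤1+n (toℕ≤pred[n] j)))

  rankingOrCycle : ∃ (Ranking G) ⊎ ∃[ u ] TransClosure (Arc G) u u
  rankingOrCycle with all? (λ v → height (suc n) v ≤? height n v)
  ... | yes stable  = inj₁ (height n , λ u v uv → ≤-trans (height-arc n uv) (stable v))
  ... | no unstable with ¬∀⟶∃¬ n _ (λ v → height (suc n) v ≤? height n v) unstable
  ...   | v , grows = inj₂ (long-walk⇒cycle (height-growth⇒walk n (≰⇒> grows)))

acyclic? : ∀ (G : Digraph n) → Dec (Acyclic G)
acyclic? G with Height.rankingOrCycle G
... | inj₁ (_ , ranking) = yes (ranking⇒acyclic ranking)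
... | inj₂ (u , cycle)   = no λ acyclic → acyclic u cycle

acyclic⇒ranking : Acyclic G → ∃ (Ranking G)
acyclic⇒ranking {G = G} acyclic with Height.rankingOrCycle G
... | inj₁ ranking     = ranking
... | inj₂ (u , cycle) = contradiction cycle (acyclic u)

order : (Fin n → ℕ) → Digraph n
order R u v = R u <ᵇ R v

order-ranking : ∀ (R : Fin n → ℕ) → Ranking (order R) R
order-ranking R u v = <ᵇ⇒< (R u) (R v) ∘ Equivalence.from T-≡

<⇒order-arc : ∀ (R : Fin n → ℕ) {u v} → R u < R v → Arc (order R) u v
<⇒order-arc R = Equivalence.to T-≡ ∘ <⇒<ᵇ

order-tournament : ∀ {R : Fin n → ℕ} → Injective _≡_ _≡_ R → Tournament (order R)
order-tournament {R = R} injective = (loopless , antisym) , total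
  where
  loopless : ∀ u → ¬ Arc (order R) u u
  loopless u uu = <-irrefl refl (order-ranking R u u uu)

  antisym : ∀ u v → Arc (order R) u v → ¬ Arc (order R) v u
  antisym u v uv vu = <-asym (order-ranking R u v uv) (order-ranking R v u vu)

  total : ∀ u v → u ≢ v → Arc (order R) u v ⊎ Arc (order R) v u
  total u v u≢v with <-cmp (R u) (R v)
  ... | tri< lt _ _ = inj₁ (<⇒order-arc R lt)
  ... | tri≈ _ eq _ = contradiction (injective eq) u≢v
  ... | tri> _ _ gt = inj₂ (<⇒order-arc R gt)

-- Ties of r are broken by the vertex index, read off as the remainder mod n.
refine : (Fin n → ℕ) → Fin n → ℕ
refine {n} r u = toℕ u + r u * n

refine-mono : ∀ (r : Fin n → ℕ) {u v} → r u < r v → refine r u < refine r v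
refine-mono {n} r {u} {v} ru<rv =
  <-≤-trans (+-monoˡ-< (r u * n) (toℕ<n u))
            (≤-trans (*-monoˡ-≤ n ru<rv) (m≤n+m (r v * n) (toℕ v)))

refine-injective : ∀ (r : Fin n → ℕ) → Injective _≡_ _≡_ (refine r)
refine-injective {n = suc m} r {u} {v} eq = toℕ-injective (begin
  toℕ u                        ≡⟨ m<n⇒m%n≡m (toℕ<n u) ⟨
  toℕ u % suc m                ≡⟨ [m+kn]%n≡m%n (toℕ u) (r u) (suc m) ⟨
  refine r u % suc m           ≡⟨ cong (_% suc m) eq ⟩
  refine r v % suc m           ≡⟨ [m+kn]%n≡m%n (toℕ v) (r v) (suc m) ⟩
  toℕ v % suc m                ≡⟨ m<n⇒m%n≡m (toℕ<n v) ⟩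
  toℕ v                        ∎)
  where open ≡-Reasoning

acyclic⇒⊆acyclicTournament : Acyclic G →
  Σ[ T ∈ Digraph n ] Tournament T × ArcSubset G T × Acyclic T
acyclic⇒⊆acyclicTournament acyclic with acyclic⇒ranking acyclic
... | r , ranking =
  order (refine r) ,
  order-tournament (refine-injective r) ,
  (λ u v uv → <⇒order-arc (refine r) (refine-mono r (ranking u v uv))) ,
  ranking⇒acyclic (order-ranking (refine r))

Backward : Digraph n → Fin n → Fin n → Set
Backward G u v = Arc G u v × toℕ v < toℕ u

backward? : ∀ (G : Digraph n) u v → Dec (Backward G u v)
backward? G u v = (G u v Data.Bool.≟ true) Dec.×-dec (toℕ v <? toℕ u)

endpoints : Fin n → Fin n → Subset n
endpoints a b = ⁅ a ⁆ ∪ ⁅ b ⁆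

inside-endpoints : ∀ (a b x : Fin n) → inside (endpoints a b) x ≡ true ⇔ (x ≡ a ⊎ x ≡ b)
inside-endpoints a b x = mk⇔
  (λ x∈ → Sum.map (x∈⁅y⁆⇒x≡y a) (x∈⁅y⁆⇒x≡y b) (x∈p∪q⁻ ⁅ a ⁆ ⁅ b ⁆ (lookup⇒[]= _ _ x∈)))
  (λ { (inj₁ refl) → []=⇒lookup (x∈p∪q⁺ (inj₁ (x∈⁅x⁆ a)))
     ; (inj₂ refl) → []=⇒lookup (x∈p∪q⁺ {p = ⁅ a ⁆} (inj₂ (x∈⁅x⁆ b))) })

-- Inverting the two endpoints of an arc reverses that arc and nothing else.
invert-endpoints-backward : ∀ {a b u v : Fin n} → Oriented G → Backward G a b →
  Backward (invert G (endpoints a b)) u v → Backward G u v × (u , v) ≢ (a , b)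
invert-endpoints-backward {a = a} {b} {u} {v} (_ , antisym) (ab , b<a) (uv , v<u)
  with inside (endpoints a b) u in u∈ | inside (endpoints a b) v in v∈
... | false | _     = (uv , v<u) , λ eq →
  contradiction (trans (sym u∈) (Equivalence.from (inside-endpoints a b u) (inj₁ (cong proj₁ eq)))) λ ()
... | true  | false = (uv , v<u) , λ eq →
  contradiction (trans (sym v∈) (Equivalence.from (inside-endpoints a b v) (inj₂ (cong proj₂ eq)))) λ ()
... | true  | true
  with Equivalence.to (inside-endpoints a b u) u∈ | Equivalence.to (inside-endpoints a b v) v∈
...   | inj₁ refl | inj₁ refl = contradiction v<u (<-irrefl refl)
...   | inj₁ refl | inj₂ refl = contradiction uv (antisym _ _ ab)
...   | inj₂ refl | inj₁ refl = contradiction v<u (<-asym b<a)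
...   | inj₂ refl | inj₂ refl = contradiction v<u (<-irrefl refl)

removeBackward : Oriented G → ∀ (ps : List (Fin n × Fin n)) →
  ∃[ Xs ] (∀ u v → Backward (invertAll G Xs) u v → Backward G u v × (u , v) ∉ ps)
removeBackward oriented [] = [] , λ u v uv → uv , λ ()
removeBackward {G = G} oriented ((a , b) ∷ ps) with backward? G a b
... | yes ab with removeBackward (invert-oriented (endpoints a b) oriented) ps
...   | Xs , removed = endpoints a b ∷ Xs , λ u v uv →
  let (uv′ , ∉ps) = removed u v uv
      (uv″ , ≢ab) = invert-endpoints-backward oriented ab uv′
  in uv″ , λ { (here eq) → ≢ab eq ; (there ∈ps) → ∉ps ∈ps }
removeBackward {G = G} oriented ((a , b) ∷ ps) | no ¬ab with removeBackward oriented ps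
...   | Xs , removed = Xs , λ u v uv →
  let (uv′ , ∉ps) = removed u v uv
  in uv′ , λ { (here eq) → ¬ab (subst (λ (x , y) → Backward G x y) eq uv′) ; (there ∈ps) → ∉ps ∈ps }

oriented⇒acyclicAfter : Oriented G → ∃ (AcyclicAfter G)
oriented⇒acyclicAfter {n} {G} oriented
  with removeBackward oriented (cartesianProduct (allFin n) (allFin n))
... | Xs , removed = length Xs , Xs , refl , ranking⇒acyclic forward
  where
  forward : Ranking (invertAll G Xs) toℕ
  forward u v uv with <-cmp (toℕ u) (toℕ v)
  ... | tri< lt _ _ = lt
  ... | tri≈ _ eq _ = contradiction (subst (Arc (invertAll G Xs) u) (sym (toℕ-injective eq)) uv)
                        (proj₁ (invertAll-preserves Oriented invert-oriented Xs oriented) u)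
  ... | tri> _ _ gt = contradiction (∈-cartesianProduct⁺ (∈-allFin u) (∈-allFin v))
                        (proj₂ (removed u v (uv , gt)))

minimal-witness : ∀ {P : ℕ → Set} → Decidable P → ∀ m → P m → ∃[ k ] P k × (∀ j → j < k → ¬ P j)
minimal-witness {P = P} P? = <-rec _ step
  where
  step : ∀ m → (∀ {j} → j < m → P j → ∃[ k ] P k × (∀ j → j < k → ¬ P j)) →
         P m → ∃[ k ] P k × (∀ j → j < k → ¬ P j)
  step m smaller pm with anyUpTo? P? m
  ... | yes (j , j<m , pj) = smaller j<m pj
  ... | no none            = m , pm , λ j j<m pj → none (j , j<m , pj)

acyclicAfter? : ∀ (G : Digraph n) k → Dec (AcyclicAfter G k)
acyclicAfter? G zero = Dec.map′ (λ acyclic → [] , refl , acyclic)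
  (λ { ([] , _ , acyclic) → acyclic ; (_ ∷ _ , () , _) }) (acyclic? G)
acyclicAfter? G (suc k) = Dec.map′
  (λ (X , Xs , len , acyclic) → X ∷ Xs , cong suc len , acyclic)
  (λ { ([] , () , _) ; (X ∷ Xs , len , acyclic) → X , Xs , suc-injective len , acyclic })
  (anySubset? (λ X → acyclicAfter? (invert G X) k))

acyclicAfter-anti : ArcSubset G H → AcyclicAfter H k → AcyclicAfter G k
acyclicAfter-anti G⊆H (Xs , len , acyclic) = Xs , len , acyclic-anti (invertAll-⊆ Xs G⊆H) acyclic

oriented⇒IsInv : Oriented G → ∃ (IsInv G)
oriented⇒IsInv {G = G} oriented with oriented⇒acyclicAfter oriented
... | m , after = minimal-witness (acyclicAfter? G) m after

IsInv-unique : ∀ {j k} → IsInv G j → IsInv G k → j ≡ k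
IsInv-unique {j = j} {k = k} (afterj , minimalj) (afterk , minimalk) with <-cmp j k
... | tri< j<k _ _ = contradiction afterj (minimalk j j<k)
... | tri≈ _ j≡k _ = j≡k
... | tri> _ _ k<j = contradiction afterk (minimalj k k<j)

IsInv-⇔ : IsInv G k → IsInv H k → ∀ j → IsInv G j ⇔ IsInv H j
IsInv-⇔ {G = G} {H = H} invG invH j = mk⇔
  (λ invG′ → subst (IsInv H) (IsInv-unique invG invG′) invH)
  (λ invH′ → subst (IsInv G) (IsInv-unique invH invH′) invG)

IsInv-supergraph : ArcSubset G H → IsInv G k → AcyclicAfter H k → IsInv H k
IsInv-supergraph G⊆H (_ , minimal) afterH =
  afterH , λ j j<k → minimal j j<k ∘ acyclicAfter-anti G⊆H

lemma2p4 : (n : ℕ) (D : Digraph n) → Oriented D →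
    Σ (Digraph n) (λ T → Tournament T × ArcSubset D T × ((k : ℕ) → IsInv D k ⇔ IsInv T k))
lemma2p4 n D oriented
  with k , invD@((Xs , len , acyclicD′) , _) ← oriented⇒IsInv oriented
  with T′ , tournamentT′ , D′⊆T′ , acyclicT′ ← acyclic⇒⊆acyclicTournament acyclicD′
  = T , invertAll-preserves Tournament invert-tournament (reverse Xs) tournamentT′ , D⊆T
      , IsInv-⇔ invD (IsInv-supergraph D⊆T invD (Xs , len , acyclicT))
  where
  T : Digraph n
  T = invertAll T′ (reverse Xs)

  D⊆T : ArcSubset D T
  D⊆T = ⊆-trans (≐⇒⊇ (invertAll-reverse-inverseʳ Xs)) (invertAll-⊆ (reverse Xs) D′⊆T′)

  acyclicT : Acyclic (invertAll T Xs)
  acyclicT = acyclic-anti (≐⇒⊆ (invertAll-reverse-inverseˡ Xs)) acyclicT′
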